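{- Let $X_n$ be the number of ascents in a Schröder path chosen uniformly at random among all Schröder paths of length $2n$. Then $\mathbb{E}(X_n)\sim(\sqrt{2}-1)\,n$ as $n\to\infty$.
   Context: A Schröder path of length $2n$ is a lattice path with steps $U=(1,1)$, $D=(1,-1)$ and $F=(2,0)$ starting at $(0,0)$, ending at $(2n,0)$ and never going below the $x$-axis. An ascent is a maximal (nonempty) string of consecutive $U$-steps. -}

module Defs where

open import Data.Nat using (ℕ; zero; suc)
open import Data.Bool using (Bool; true; false; if_then_else_)
open import Data.List using (List; []; _∷_; map; _++_; filter; length)
open import Data.Nat.ListAction using (sum)
open import Data.Integer using (+_)
open import Data.Rational.Unnormalised.Base using (ℚᵘ; 0ℚᵘ; 1ℚᵘ; _/_; _+_; _*_; _<_)
open import Data.Sum using (_⊎_)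
open import Data.Product using (_×_)
open import Relation.Binary.PropositionalEquality using (_≡_)
open import Relation.Nullary.Decidable using (Dec; yes; no)
open import Data.Bool.Properties using () renaming (_≟_ to _≟ᵇ_)

-- Steps: U = (1,1), D = (1,-1), F = (2,0)
data Step : Set where
  U D F : Step

-- All step words whose total horizontal length is exactly m
-- (U and D have length 1, F has length 2).  Each word appears exactly once.
words : ℕ → List (List Step)
words zero = [] ∷ []
words (suc zero) = (U ∷ []) ∷ (D ∷ []) ∷ []
words (suc (suc m)) =
  map (U ∷_) (words (suc m)) ++ map (D ∷_) (words (suc m)) ++ map (F ∷_) (words m)

validFrom : ℕ → List Step → Bool
validFrom zero [] = true
validFrom (suc h) [] = false
validFrom h (U ∷ w) = validFrom (suc h) w
validFrom zero (D ∷ w) = false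
validFrom (suc h) (D ∷ w) = validFrom h w
validFrom h (F ∷ w) = validFrom h w

isSchroeder : List Step → Bool
isSchroeder = validFrom 0

schroederPaths : ℕ → List (List Step)
schroederPaths n = filter (λ w → isSchroeder w ≟ᵇ true) (words (n Data.Nat.* 2))

-- Number of ascents (maximal nonempty runs of U-steps).
-- ascentsAux b w : b = "previous step was U".
ascentsAux : Bool → List Step → ℕ
ascentsAux b [] = 0
ascentsAux true (U ∷ w) = ascentsAux true w
ascentsAux false (U ∷ w) = suc (ascentsAux true w)
ascentsAux b (D ∷ w) = ascentsAux false w
ascentsAux b (F ∷ w) = ascentsAux false w

ascents : List Step → ℕ
ascents = ascentsAux false

-- a / b as an unnormalised rational (b = 0 never occurs below; returns 0 then).
ratio : ℕ → ℕ → ℚᵘ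
ratio a zero = 0ℚᵘ
ratio a (suc b) = (+ a) / suc b

expectedAscents : ℕ → ℚᵘ
expectedAscents n =
  ratio (sum (map ascents (schroederPaths n))) (length (schroederPaths n))

fromℕ : ℕ → ℚᵘ
fromℕ n = (+ n) / 1

two : ℚᵘ
two = (+ 2) / 1

-- q < √2 - 1   (Dedekind cut of √2 - 1 on the rationals)
BelowSqrt2m1 : ℚᵘ → Set
BelowSqrt2m1 q = ((q + 1ℚᵘ) < 0ℚᵘ) ⊎ (((q + 1ℚᵘ) * (q + 1ℚᵘ)) < two)

AboveSqrt2m1 : ℚᵘ → Set
AboveSqrt2m1 q = (0ℚᵘ < (q + 1ℚᵘ)) × (two < ((q + 1ℚᵘ) * (q + 1ℚᵘ)))

module Submission where

-- Sorting the paths from height h by their first step shows that the number S k n of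
-- paths of length 2n + k - 1 from height k - 1, and the total number of ascents over
-- them, satisfy recurrences in (k, n).  Induction over both indices gives closed forms
-- for twice these ascent totals and the three-term recurrence
-- (n + 3) r (n + 2) = (6n + 9) r (n + 1) - n r n for the large Schröder numbers
-- r n = S 1 n.  The ascents of all Schröder paths of length 2(m + 1) therefore total
-- (m + 2)(r (m + 1) - r m) / 2, so E(X (m + 1)) = (m + 2)(1 - r m / r (m + 1)) / 2.
-- Along the recurrence the quadratic form Q z x = 6zx - z² - x² stays positive at
-- (r (n + 1), r n), while (n + 2)² Q ≤ 64 (n + 1) (r n)²; hence r (n + 1) / r n stays
-- below the root 3 + 2√2 of Q and approaches it at rate O(1/n).  Since
-- (1 - (3 - 2√2)) / 2 = √2 - 1, this gives both bounds.  Every inequality is proved by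
-- writing the quantity as a combination of non-negative terms, the identity being
-- checked by the ring solver.

open import Defs

module Enumeration where
  open import Data.Bool using (Bool; true; false)
  open import Data.Bool.Properties using () renaming (_≟_ to _≟ᵇ_)
  open import Data.List using (List; []; _∷_; map; _++_; filter; length)
  open import Data.List.Properties using (filter-++; map-++; map-∘; map-cong; filter-none)
  open import Data.List.Relation.Unary.All using (universal)
  open import Data.List.Relation.Unary.All.Properties using (map⁺)
  open import Data.Nat
  open import Data.Nat.ListAction using (sum)
  open import Data.Nat.ListAction.Properties using (sum-++)
  open import Data.Nat.Properties
  open import Algebra.Properties.CommutativeSemigroup +-commutativeSemigroup using (x∙yz≈y∙xz)
  open import Function using (_∘_)
  open import Relation.Binary.PropositionalEquality
  open import Relation.Nullary using (does)
  open import Relation.Unary using (Pred; Decidable)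

  filter-map-commute : ∀ {a b p q} {A : Set a} {B : Set b} {P : Pred B p} {Q : Pred A q}
    (P? : Decidable P) (Q? : Decidable Q) (f : A → B) →
    (∀ x → does (P? (f x)) ≡ does (Q? x)) →
    ∀ xs → filter P? (map f xs) ≡ map f (filter Q? xs)
  filter-map-commute P? Q? f same [] = refl
  filter-map-commute P? Q? f same (x ∷ xs) with does (P? (f x)) | does (Q? x) | same x
  ... | true  | .true  | refl = cong (f x ∷_) (filter-map-commute P? Q? f same xs)
  ... | false | .false | refl = filter-map-commute P? Q? f same xs

  validPaths : ℕ → List (List Step) → List (List Step)
  validPaths h = filter (λ w → validFrom h w ≟ᵇ true)

  validPaths-map : ∀ h h′ s → (∀ w → validFrom h (s ∷ w) ≡ validFrom h′ w) →
    ∀ ws → validPaths h (map (s ∷_) ws) ≡ map (s ∷_) (validPaths h′ ws)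
  validPaths-map h h′ s same =
    filter-map-commute (λ w → validFrom h w ≟ᵇ true) (λ w → validFrom h′ w ≟ᵇ true) (s ∷_)
      (λ w → cong (λ v → does (v ≟ᵇ true)) (same w))

  validPaths-U : ∀ h ws → validPaths h (map (U ∷_) ws) ≡ map (U ∷_) (validPaths (suc h) ws)
  validPaths-U zero    = validPaths-map 0 1 U (λ _ → refl)
  validPaths-U (suc h) = validPaths-map (suc h) (2+ h) U (λ _ → refl)

  validPaths-D : ∀ h ws → validPaths (suc h) (map (D ∷_) ws) ≡ map (D ∷_) (validPaths h ws)
  validPaths-D h = validPaths-map (suc h) h D (λ _ → refl)

  validPaths-D-ground : ∀ ws → validPaths 0 (map (D ∷_) ws) ≡ []
  validPaths-D-ground ws = filter-none _ (map⁺ (universal (λ _ ()) ws))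

  validPaths-F : ∀ h ws → validPaths h (map (F ∷_) ws) ≡ map (F ∷_) (validPaths h ws)
  validPaths-F zero    = validPaths-map 0 0 F (λ _ → refl)
  validPaths-F (suc h) = validPaths-map (suc h) (suc h) F (λ _ → refl)

  total : (List Step → ℕ) → ℕ → List (List Step) → ℕ
  total f h ws = sum (map f (validPaths h ws))

  sum-map-+ : ∀ {a} {A : Set a} (f g : A → ℕ) xs →
    sum (map (λ x → f x + g x) xs) ≡ sum (map f xs) + sum (map g xs)
  sum-map-+ f g [] = refl
  sum-map-+ f g (x ∷ xs) = begin
    f x + g x + sum (map (λ x → f x + g x) xs)   ≡⟨ cong (f x + g x +_) (sum-map-+ f g xs) ⟩
    f x + g x + (sum (map f xs) + sum (map g xs)) ≡⟨ +-assoc (f x) (g x) _ ⟩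
    f x + (g x + (sum (map f xs) + sum (map g xs))) ≡⟨ cong (f x +_) (x∙yz≈y∙xz (g x) (sum (map f xs)) _) ⟩
    f x + (sum (map f xs) + (g x + sum (map g xs))) ≡⟨ sym (+-assoc (f x) _ _) ⟩
    f x + sum (map f xs) + (g x + sum (map g xs)) ∎
    where open ≡-Reasoning

  total-+ : ∀ f g h ws → total (λ w → f w + g w) h ws ≡ total f h ws + total g h ws
  total-+ f g h ws = sum-map-+ f g (validPaths h ws)

  total-map : ∀ f s h h′ ws → validPaths h (map (s ∷_) ws) ≡ map (s ∷_) (validPaths h′ ws) →
    total f h (map (s ∷_) ws) ≡ total (f ∘ (s ∷_)) h′ ws
  total-map f s h h′ ws eq = begin
    sum (map f (validPaths h (map (s ∷_) ws)))  ≡⟨ cong (sum ∘ map f) eq ⟩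
    sum (map f (map (s ∷_) (validPaths h′ ws))) ≡⟨ cong sum (map-∘ (validPaths h′ ws)) ⟨
    sum (map (f ∘ (s ∷_)) (validPaths h′ ws))   ∎
    where open ≡-Reasoning

  total-words : ∀ f h m → total f h (words (2+ m)) ≡
    total (f ∘ (U ∷_)) (suc h) (words (suc m)) +
    (total f h (map (D ∷_) (words (suc m))) + total (f ∘ (F ∷_)) h (words m))
  total-words f h m = begin
    sum (map f (validPaths h (Us ++ Ds ++ Fs)))
      ≡⟨ cong (sum ∘ map f) (trans (filter-++ _ Us (Ds ++ Fs)) (cong (validPaths h Us ++_) (filter-++ _ Ds Fs))) ⟩
    sum (map f (validPaths h Us ++ validPaths h Ds ++ validPaths h Fs))
      ≡⟨ sum-map-++³ (validPaths h Us) (validPaths h Ds) (validPaths h Fs) ⟩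
    total f h Us + (total f h Ds + total f h Fs)
      ≡⟨ cong₂ (λ u v → u + (total f h Ds + v))
           (total-map f U h (suc h) (words (suc m)) (validPaths-U h (words (suc m))))
           (total-map f F h h (words m) (validPaths-F h (words m))) ⟩
    total (f ∘ (U ∷_)) (suc h) (words (suc m)) + (total f h Ds + total (f ∘ (F ∷_)) h (words m)) ∎
    where
    open ≡-Reasoning
    Us Ds Fs : List (List Step)
    Us = map (U ∷_) (words (suc m))
    Ds = map (D ∷_) (words (suc m))
    Fs = map (F ∷_) (words m)
    sum-map-++³ : ∀ xs ys zs → sum (map f (xs ++ ys ++ zs)) ≡ sum (map f xs) + (sum (map f ys) + sum (map f zs))
    sum-map-++³ xs ys zs = begin
      sum (map f (xs ++ ys ++ zs))             ≡⟨ cong sum (map-++ f xs (ys ++ zs)) ⟩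
      sum (map f xs ++ map f (ys ++ zs))       ≡⟨ sum-++ (map f xs) _ ⟩
      sum (map f xs) + sum (map f (ys ++ zs))  ≡⟨ cong (sum (map f xs) +_) (cong sum (map-++ f ys zs)) ⟩
      sum (map f xs) + sum (map f ys ++ map f zs) ≡⟨ cong (sum (map f xs) +_) (sum-++ (map f ys) _) ⟩
      sum (map f xs) + (sum (map f ys) + sum (map f zs)) ∎

  total-D-ground : ∀ f ws → total f 0 (map (D ∷_) ws) ≡ 0
  total-D-ground f ws = cong (sum ∘ map f) (validPaths-D-ground ws)

  total-D : ∀ f h ws → total f (suc h) (map (D ∷_) ws) ≡ total (f ∘ (D ∷_)) h ws
  total-D f h ws = total-map f D (suc h) h ws (validPaths-D h ws)

  pathCount : ℕ → ℕ → ℕ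
  pathCount zero       zero       = 1
  pathCount zero       (suc h)    = 0
  pathCount (suc zero) zero       = 0
  pathCount (suc zero) (suc zero) = 1
  pathCount (suc zero) (2+ h)     = 0
  pathCount (2+ m)     zero       = pathCount (suc m) 1 + pathCount m 0
  pathCount (2+ m)     (suc h)    = pathCount (suc m) (2+ h) + (pathCount (suc m) h + pathCount m (suc h))

  -- The first U-step opens a new ascent exactly when the previous step was not U.
  ascentStart : Bool → ℕ → ℕ
  ascentStart true  _ = 0
  ascentStart false c = c

  ascentCount : Bool → ℕ → ℕ → ℕ
  ascentCount b zero       h       = 0
  ascentCount b (suc zero) h       = 0
  ascentCount b (2+ m)     zero    =
    (ascentStart b (pathCount (suc m) 1) + ascentCount true (suc m) 1) + ascentCount false m 0
  ascentCount b (2+ m)     (suc h) =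
    (ascentStart b (pathCount (suc m) (2+ h)) + ascentCount true (suc m) (2+ h)) +
    (ascentCount false (suc m) h + ascentCount false m (suc h))

  total-pathCount : ∀ m h → total (λ _ → 1) h (words m) ≡ pathCount m h
  total-pathCount zero       zero       = refl
  total-pathCount zero       (suc h)    = refl
  total-pathCount (suc zero) zero       = refl
  total-pathCount (suc zero) (suc zero) = refl
  total-pathCount (suc zero) (2+ h)     = refl
  total-pathCount (2+ m)     zero       = trans (total-words _ 0 m)
    (cong₂ _+_ (total-pathCount (suc m) 1)
               (cong₂ _+_ (total-D-ground _ (words (suc m))) (total-pathCount m 0)))
  total-pathCount (2+ m)     (suc h)    = trans (total-words _ (suc h) m)
    (cong₂ _+_ (total-pathCount (suc m) (2+ h))
               (cong₂ _+_ (trans (total-D _ h (words (suc m))) (total-pathCount (suc m) h))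
                          (total-pathCount m (suc h))))

  total-cong : ∀ {f g} → f ≗ g → ∀ h ws → total f h ws ≡ total g h ws
  total-cong f≗g h ws = cong sum (map-cong f≗g (validPaths h ws))

  ascentsAux-D : ∀ b w → ascentsAux b (D ∷ w) ≡ ascentsAux false w
  ascentsAux-D true  w = refl
  ascentsAux-D false w = refl

  ascentsAux-F : ∀ b w → ascentsAux b (F ∷ w) ≡ ascentsAux false w
  ascentsAux-F true  w = refl
  ascentsAux-F false w = refl

  total-ascents-U : ∀ b h ws →
    total (λ w → ascentsAux b (U ∷ w)) h ws ≡ ascentStart b (total (λ _ → 1) h ws) + total (ascentsAux true) h ws
  total-ascents-U true  h ws = refl
  total-ascents-U false h ws = total-+ (λ _ → 1) (ascentsAux true) h ws

  total-ascentCount : ∀ b m h → total (ascentsAux b) h (words m) ≡ ascentCount b m h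
  total-ascentCount b     zero       zero       = refl
  total-ascentCount b     zero       (suc h)    = refl
  total-ascentCount b     (suc zero) zero       = refl
  total-ascentCount true  (suc zero) (suc zero) = refl
  total-ascentCount false (suc zero) (suc zero) = refl
  total-ascentCount b     (suc zero) (2+ h)     = refl
  total-ascentCount b     (2+ m)     zero       = trans (total-words _ 0 m)
    (cong₂ _+_ (trans (total-ascents-U b 1 (words (suc m)))
                      (cong₂ _+_ (cong (ascentStart b) (total-pathCount (suc m) 1)) (total-ascentCount true (suc m) 1)))
               (cong₂ _+_ (total-D-ground _ (words (suc m)))
                          (trans (total-cong (ascentsAux-F b) 0 (words m)) (total-ascentCount false m 0))))
  total-ascentCount b     (2+ m)     (suc h)    = trans (total-words _ (suc h) m)
    (cong₂ _+_ (trans (total-ascents-U b (2+ h) (words (suc m)))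
                      (cong₂ _+_ (cong (ascentStart b) (total-pathCount (suc m) (2+ h)))
                                 (total-ascentCount true (suc m) (2+ h))))
               (cong₂ _+_ (trans (total-D _ h (words (suc m)))
                                 (trans (total-cong (ascentsAux-D b) h (words (suc m))) (total-ascentCount false (suc m) h)))
                          (trans (total-cong (ascentsAux-F b) (suc h) (words m)) (total-ascentCount false m (suc h)))))

  -- Row 0 (start height -1) only serves to make the recurrence uniform.
  schroeder : ℕ → ℕ → ℕ
  schroeder zero    zero    = 1
  schroeder zero    (suc n) = 0
  schroeder (suc k) zero    = 1
  schroeder (suc k) (suc n) = schroeder (2+ k) n + (schroeder k (suc n) + schroeder (suc k) n)

  schroederAscents : Bool → ℕ → ℕ → ℕ
  schroederAscents b k          zero    = 0
  schroederAscents b zero       (suc n) = 0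
  schroederAscents b (suc zero) (suc n) =
    (ascentStart b (schroeder 2 n) + schroederAscents true 2 n) + schroederAscents false 1 n
  schroederAscents b (2+ j)     (suc n) =
    (ascentStart b (schroeder (suc (2+ j)) n) + schroederAscents true (suc (2+ j)) n) +
    (schroederAscents false (suc j) (suc n) + schroederAscents false (2+ j) n)

  schroeder-pos : ∀ k n → 1 ≤ schroeder (suc k) n
  schroeder-pos k zero    = s≤s z≤n
  schroeder-pos k (suc n) =
    ≤-trans (schroeder-pos k n) (≤-trans (m≤n+m _ (schroeder k (suc n))) (m≤n+m _ (schroeder (2+ k) n)))

  pathCount-below : ∀ {m h} → m < h → pathCount m h ≡ 0
  pathCount-below {zero}   {suc h}    _ = refl
  pathCount-below {suc zero} {2+ h}   _ = refl
  pathCount-below {suc zero} {suc zero} (s≤s ())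
  pathCount-below {2+ m}   {2+ h} (s≤s (s≤s m<h)) =
    cong₂ _+_ (pathCount-below (s≤s (s≤s (m≤n⇒m≤1+n (<⇒≤ m<h)))))
              (cong₂ _+_ (pathCount-below (s≤s m<h)) (pathCount-below (m≤n⇒m≤1+n (m≤n⇒m≤1+n m<h))))
  pathCount-below {2+ m}   {suc zero} (s≤s ())

  pathCount-diag : ∀ h → pathCount h h ≡ 1
  pathCount-diag zero       = refl
  pathCount-diag (suc zero) = refl
  pathCount-diag (2+ h)     =
    cong₂ _+_ (pathCount-below (n≤1+n (2+ h))) (cong₂ _+_ (pathCount-diag (suc h)) (pathCount-below (n≤1+n (suc h))))

  ascentStart-0 : ∀ b → ascentStart b 0 ≡ 0
  ascentStart-0 true  = refl
  ascentStart-0 false = refl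

  ascentCount-below : ∀ b {m h} → m ≤ h → ascentCount b m h ≡ 0
  ascentCount-below b {zero}     _ = refl
  ascentCount-below b {suc zero} _ = refl
  ascentCount-below b {2+ m} {2+ h} (s≤s (s≤s m≤h)) =
    cong₂ _+_
      (cong₂ _+_ (trans (cong (ascentStart b) (pathCount-below (s≤s (s≤s (m≤n⇒m≤1+n m≤h))))) (ascentStart-0 b))
                 (ascentCount-below true (s≤s (m≤n⇒m≤1+n (m≤n⇒m≤1+n m≤h)))))
      (cong₂ _+_ (ascentCount-below false (s≤s m≤h)) (ascentCount-below false (m≤n⇒m≤1+n (m≤n⇒m≤1+n m≤h))))

  pathCount-schroeder : ∀ n h → pathCount (n * 2 + h) h ≡ schroeder (suc h) n
  pathCount-schroeder zero    h       = pathCount-diag h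
  pathCount-schroeder (suc n) zero    =
    cong₂ _+_ (trans (cong (λ m → pathCount m 1) (sym (+-suc (n * 2) 0))) (pathCount-schroeder n 1))
              (pathCount-schroeder n 0)
  pathCount-schroeder (suc n) (suc h) =
    cong₂ _+_ (trans (cong (λ m → pathCount m (2+ h)) (sym (+-suc (n * 2) (suc h)))) (pathCount-schroeder n (2+ h)))
              (cong₂ _+_ (trans (cong (λ m → pathCount (suc m) h) (+-suc (n * 2) h)) (pathCount-schroeder (suc n) h))
                         (pathCount-schroeder n (suc h)))

  ascentCount-schroederAscents : ∀ b n h → ascentCount b (n * 2 + h) h ≡ schroederAscents b (suc h) n
  ascentCount-schroederAscents b zero    h       = ascentCount-below b {h} ≤-refl
  ascentCount-schroederAscents b (suc n) zero    =
    cong₂ _+_ (cong₂ _+_ (cong (ascentStart b) (trans (cong (λ m → pathCount m 1) (sym (+-suc (n * 2) 0)))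
                                                      (pathCount-schroeder n 1)))
                         (trans (cong (λ m → ascentCount true m 1) (sym (+-suc (n * 2) 0)))
                                (ascentCount-schroederAscents true n 1)))
              (ascentCount-schroederAscents false n 0)
  ascentCount-schroederAscents b (suc n) (suc h) =
    cong₂ _+_ (cong₂ _+_ (cong (ascentStart b) (trans (cong (λ m → pathCount m (2+ h)) (sym (+-suc (n * 2) (suc h))))
                                                      (pathCount-schroeder n (2+ h))))
                         (trans (cong (λ m → ascentCount true m (2+ h)) (sym (+-suc (n * 2) (suc h))))
                                (ascentCount-schroederAscents true n (2+ h))))
              (cong₂ _+_ (trans (cong (λ m → ascentCount false (suc m) h) (+-suc (n * 2) h))
                                (ascentCount-schroederAscents false (suc n) h))
                         (ascentCount-schroederAscents false n (suc h)))

  length-as-total : ∀ h ws → length (validPaths h ws) ≡ total (λ _ → 1) h ws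
  length-as-total h ws = go (validPaths h ws)
    where
    go : (xs : List (List Step)) → length xs ≡ sum (map (λ _ → 1) xs)
    go []       = refl
    go (x ∷ xs) = cong suc (go xs)

  length-schroederPaths : ∀ n → length (schroederPaths n) ≡ schroeder 1 n
  length-schroederPaths n = begin
    length (schroederPaths n)             ≡⟨ length-as-total 0 (words (n * 2)) ⟩
    total (λ _ → 1) 0 (words (n * 2))     ≡⟨ total-pathCount (n * 2) 0 ⟩
    pathCount (n * 2) 0                   ≡⟨ cong (λ m → pathCount m 0) (+-identityʳ (n * 2)) ⟨
    pathCount (n * 2 + 0) 0               ≡⟨ pathCount-schroeder n 0 ⟩
    schroeder 1 n                         ∎
    where open ≡-Reasoning

  sum-ascents-schroederPaths : ∀ n → sum (map ascents (schroederPaths n)) ≡ schroederAscents false 1 n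
  sum-ascents-schroederPaths n = begin
    total ascents 0 (words (n * 2))       ≡⟨ total-ascentCount false (n * 2) 0 ⟩
    ascentCount false (n * 2) 0           ≡⟨ cong (λ m → ascentCount false m 0) (+-identityʳ (n * 2)) ⟨
    ascentCount false (n * 2 + 0) 0       ≡⟨ ascentCount-schroederAscents false n 0 ⟩
    schroederAscents false 1 n            ∎
    where open ≡-Reasoning

module ClosedForms where
  open Enumeration using (schroeder; schroederAscents)
  open import Data.Bool using (Bool; true; false)
  open import Data.Integer using (ℤ; +_; 0ℤ; _+_; _*_; _-_)
  open import Data.Integer.Properties using (*-zeroʳ; +-identityʳ)
  open import Data.Integer.Tactic.RingSolver using (solve; solve-∀)
  open import Data.List using (_∷_; [])
  open import Data.Nat using (ℕ; zero; suc; 2+)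
  open import Data.Product using (_×_; _,_; proj₁; proj₂)
  open import Relation.Binary.PropositionalEquality

  S : ℕ → ℕ → ℤ
  S k n = + schroeder k n

  S⁻ : ℕ → ℕ → ℤ
  S⁻ k zero    = 0ℤ
  S⁻ k (suc n) = S k n

  S-zero : ∀ k → S k 0 ≡ + 1
  S-zero zero    = refl
  S-zero (suc k) = refl

  S-recurrence : ∀ j n → S (suc j) n ≡ S⁻ (2+ j) n + (S j n + S⁻ (suc j) n)
  S-recurrence j zero    = cong (λ x → 0ℤ + (x + 0ℤ)) (sym (S-zero j))
  S-recurrence j (suc n) = refl

  x+n*S₀n≡x : ∀ x n → x + + n * S 0 n ≡ x
  x+n*S₀n≡x x zero    = +-identityʳ x
  x+n*S₀n≡x x (suc n) = trans (cong (_+_ x) (*-zeroʳ (+ suc n))) (+-identityʳ x)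

  ascentFormula : Bool → ℤ → ℤ → ℤ → ℤ → ℤ → ℤ
  ascentFormula false K N a b c = (K + N) * a - K * b - (+ 2 * K + N - + 1) * c
  ascentFormula true  K N a b c = (+ 2 - K) * b + (K + N - + 2) * a + (+ 3 - + 2 * K - N) * c

  -- The closed forms are restated in a let, which is inlined, because the ring solver
  -- does not unfold definitions.
  ascentFormula-base : ∀ K →
    let F : ℤ → ℤ → ℤ → ℤ → ℤ → ℤ
        F K N a b c = (K + N) * a - K * b - (+ 2 * K + N - + 1) * c
        T : ℤ → ℤ → ℤ → ℤ → ℤ → ℤ
        T K N a b c = (+ 2 - K) * b + (K + N - + 2) * a + (+ 3 - + 2 * K - N) * c
    in (F K 0ℤ (+ 1) (+ 1) 0ℤ ≡ 0ℤ) × (T K 0ℤ (+ 1) (+ 1) 0ℤ ≡ 0ℤ)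
  ascentFormula-base K = solve (K ∷ []) , solve (K ∷ [])

  ascentFormula-step₀ : ∀ (N g₂ g₁ g₀ p₂ p₁ : ℤ) → g₁ ≡ p₂ + (g₀ + p₁) →
    let F : ℤ → ℤ → ℤ → ℤ → ℤ → ℤ
        F K N a b c = (K + N) * a - K * b - (+ 2 * K + N - + 1) * c
        T : ℤ → ℤ → ℤ → ℤ → ℤ → ℤ
        T K N a b c = (+ 2 - K) * b + (K + N - + 2) * a + (+ 3 - + 2 * K - N) * c
    in (+ 2 * g₂ + T (+ 2) N g₂ g₁ p₂ + F (+ 1) N g₁ g₀ p₁ ≡
          F (+ 1) (+ 1 + N) (g₂ + g₁) 0ℤ g₁ + N * g₀) ×
       (+ 0   + T (+ 2) N g₂ g₁ p₂ + F (+ 1) N g₁ g₀ p₁ ≡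
          T (+ 1) (+ 1 + N) (g₂ + g₁) 0ℤ g₁ + N * g₀)
  ascentFormula-step₀ N g₂ _ g₀ p₂ p₁ refl =
    solve (N ∷ g₂ ∷ g₀ ∷ p₂ ∷ p₁ ∷ []) , solve (N ∷ g₂ ∷ g₀ ∷ p₂ ∷ p₁ ∷ [])

  ascentFormula-step : ∀ (N J A B C Y E M M′ : ℤ) → B ≡ M + (C + M′) → E ≡ B + (Y + C) →
    let F : ℤ → ℤ → ℤ → ℤ → ℤ → ℤ
        F K N a b c = (K + N) * a - K * b - (+ 2 * K + N - + 1) * c
        T : ℤ → ℤ → ℤ → ℤ → ℤ → ℤ
        T K N a b c = (+ 2 - K) * b + (K + N - + 2) * a + (+ 3 - + 2 * K - N) * c
    in (+ 2 * A + T (+ 2 + J) N A B M + (F J (+ 1 + N) E Y C + F (+ 1 + J) N B C M′) ≡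
          F (+ 1 + J) (+ 1 + N) (A + (E + B)) E B) ×
       (+ 0   + T (+ 2 + J) N A B M + (F J (+ 1 + N) E Y C + F (+ 1 + J) N B C M′) ≡
          T (+ 1 + J) (+ 1 + N) (A + (E + B)) E B)
  ascentFormula-step N J A _ C Y _ M M′ refl refl =
    solve (N ∷ J ∷ A ∷ C ∷ Y ∷ M ∷ M′ ∷ []) , solve (N ∷ J ∷ A ∷ C ∷ Y ∷ M ∷ M′ ∷ [])

  double-+³ : ∀ x y z → + 2 * (x + y + z) ≡ + 2 * x + + 2 * y + + 2 * z
  double-+³ = solve-∀

  double-+⁴ : ∀ x y z w → + 2 * (x + y + (z + w)) ≡ + 2 * x + + 2 * y + (+ 2 * z + + 2 * w)
  double-+⁴ = solve-∀

  twice-schroederAscents : ∀ b j n →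
    + 2 * + schroederAscents b (suc j) n ≡ ascentFormula b (+ suc j) (+ n) (S (suc j) n) (S j n) (S⁻ (suc j) n)
  twice-schroederAscents false j zero =
    sym (trans (cong (λ x → ascentFormula false (+ suc j) 0ℤ (+ 1) x 0ℤ) (S-zero j))
               (proj₁ (ascentFormula-base (+ suc j))))
  twice-schroederAscents true  j zero =
    sym (trans (cong (λ x → ascentFormula true (+ suc j) 0ℤ (+ 1) x 0ℤ) (S-zero j))
               (proj₂ (ascentFormula-base (+ suc j))))
  twice-schroederAscents false zero (suc n) =
    trans (double-+³ (S 2 n) (+ schroederAscents true 2 n) (+ schroederAscents false 1 n))
    (trans (cong₂ (λ x y → + 2 * S 2 n + x + y) (twice-schroederAscents true 1 n) (twice-schroederAscents false 0 n))
    (trans (proj₁ (ascentFormula-step₀ (+ n) (S 2 n) (S 1 n) (S 0 n) (S⁻ 2 n) (S⁻ 1 n) (S-recurrence 0 n)))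
    (x+n*S₀n≡x _ n)))
  twice-schroederAscents true  zero (suc n) =
    trans (double-+³ (+ 0) (+ schroederAscents true 2 n) (+ schroederAscents false 1 n))
    (trans (cong₂ (λ x y → + 0 + x + y) (twice-schroederAscents true 1 n) (twice-schroederAscents false 0 n))
    (trans (proj₂ (ascentFormula-step₀ (+ n) (S 2 n) (S 1 n) (S 0 n) (S⁻ 2 n) (S⁻ 1 n) (S-recurrence 0 n)))
    (x+n*S₀n≡x _ n)))
  twice-schroederAscents false (suc j) (suc n) =
    trans (double-+⁴ (S (suc (2+ j)) n) (+ schroederAscents true (suc (2+ j)) n)
                     (+ schroederAscents false (suc j) (suc n)) (+ schroederAscents false (2+ j) n))
    (trans (cong₂ (λ x y → + 2 * S (suc (2+ j)) n + x + y) (twice-schroederAscents true (2+ j) n)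
                  (cong₂ _+_ (twice-schroederAscents false j (suc n)) (twice-schroederAscents false (suc j) n)))
           (proj₁ (ascentFormula-step (+ n) (+ suc j) (S (suc (2+ j)) n) (S (2+ j) n) (S (suc j) n) (S j (suc n))
                     (S (suc j) (suc n)) (S⁻ (suc (2+ j)) n) (S⁻ (2+ j) n) (S-recurrence (suc j) n) refl)))
  twice-schroederAscents true  (suc j) (suc n) =
    trans (double-+⁴ (+ 0) (+ schroederAscents true (suc (2+ j)) n)
                     (+ schroederAscents false (suc j) (suc n)) (+ schroederAscents false (2+ j) n))
    (trans (cong₂ (λ x y → + 0 + x + y) (twice-schroederAscents true (2+ j) n)
                  (cong₂ _+_ (twice-schroederAscents false j (suc n)) (twice-schroederAscents false (suc j) n)))
           (proj₂ (ascentFormula-step (+ n) (+ suc j) (S (suc (2+ j)) n) (S (2+ j) n) (S (suc j) n) (S j (suc n))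
                     (S (suc j) (suc n)) (S⁻ (suc (2+ j)) n) (S⁻ (2+ j) n) (S-recurrence (suc j) n) refl)))

  -- At K = 1, where the lower row vanishes, a zero defect is the recurrence of the
  -- large Schröder numbers; the terms b₁ b₂ of the row below make it inductive in K.
  recurrenceDefect : ℤ → ℤ → ℤ → ℤ → ℤ → ℤ → ℤ → ℤ
  recurrenceDefect K N a₀ a₁ a₂ b₁ b₂ =
    (N + + 2) * a₂ - + 6 * (N + + 1) * a₁ + N * a₀ - K * (+ 3 * a₁ - a₂ + b₂ + b₁)

  recurrenceDefect-base : ∀ J →
    let Δ : ℤ → ℤ → ℤ → ℤ → ℤ → ℤ → ℤ → ℤ
        Δ K N a₀ a₁ a₂ b₁ b₂ =
          (N + + 2) * a₂ - + 6 * (N + + 1) * a₁ + N * a₀ - K * (+ 3 * a₁ - a₂ + b₂ + b₁)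
        K = + 1 + J
    in Δ K 0ℤ (+ 1) (+ 2 * K) (+ 2 * K * (K + + 2)) (+ 2 * J) (+ 2 * J * (J + + 2)) ≡ 0ℤ
  recurrenceDefect-base J = solve (J ∷ [])

  recurrenceDefect-step₀ : ∀ N a₀ c₀ c₁ c₂ →
    let Δ : ℤ → ℤ → ℤ → ℤ → ℤ → ℤ → ℤ → ℤ
        Δ K N a₀ a₁ a₂ b₁ b₂ =
          (N + + 2) * a₂ - + 6 * (N + + 1) * a₁ + N * a₀ - K * (+ 3 * a₁ - a₂ + b₂ + b₁)
        a₁ = c₀ + a₀
        a₂ = c₁ + a₁
        a₃ = c₂ + a₂
    in Δ (+ 1) (+ 1 + N) a₁ a₂ a₃ 0ℤ 0ℤ ≡ Δ (+ 1) N a₀ a₁ a₂ 0ℤ 0ℤ + Δ (+ 2) N c₀ c₁ c₂ a₁ a₂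
  recurrenceDefect-step₀ N a₀ c₀ c₁ c₂ = solve (N ∷ a₀ ∷ c₀ ∷ c₁ ∷ c₂ ∷ [])

  recurrenceDefect-step : ∀ N J a₀ b₁ c₀ c₁ c₂ d₂ d₃ →
    let Δ : ℤ → ℤ → ℤ → ℤ → ℤ → ℤ → ℤ → ℤ
        Δ K N a₀ a₁ a₂ b₁ b₂ =
          (N + + 2) * a₂ - + 6 * (N + + 1) * a₁ + N * a₀ - K * (+ 3 * a₁ - a₂ + b₂ + b₁)
        a₁ = c₀ + (b₁ + a₀)
        b₂ = a₁ + (d₂ + b₁)
        a₂ = c₁ + (b₂ + a₁)
        b₃ = a₂ + (d₃ + b₂)
        a₃ = c₂ + (b₃ + a₂)
    in Δ (+ 1 + J) (+ 1 + N) a₁ a₂ a₃ b₂ b₃ ≡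
       Δ J (+ 1 + N) b₁ b₂ b₃ d₂ d₃ + Δ (+ 1 + J) N a₀ a₁ a₂ b₁ b₂ + Δ (+ 2 + J) N c₀ c₁ c₂ a₁ a₂
  recurrenceDefect-step N J a₀ b₁ c₀ c₁ c₂ d₂ d₃ =
    solve (N ∷ J ∷ a₀ ∷ b₁ ∷ c₀ ∷ c₁ ∷ c₂ ∷ d₂ ∷ d₃ ∷ [])

  S-one : ∀ k → S k 1 ≡ + 2 * + k
  S-one zero    = refl
  S-one (suc k) = trans (cong (λ x → + 1 + (x + + 1)) (S-one k)) (identity (+ k))
    where
    identity : ∀ x → + 1 + (+ 2 * x + + 1) ≡ + 2 * (+ 1 + x)
    identity = solve-∀

  S-two : ∀ k → S k 2 ≡ + 2 * + k * (+ k + + 2)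
  S-two zero    = refl
  S-two (suc k) =
    trans (cong₂ (λ x y → x + (y + S (suc k) 1)) (S-one (2+ k)) (S-two k))
          (trans (cong (λ x → + 2 * + 2+ k + (+ 2 * + k * (+ k + + 2) + x)) (S-one (suc k))) (identity (+ k)))
    where
    identity : ∀ x → + 2 * (+ 2 + x) + (+ 2 * x * (x + + 2) + + 2 * (+ 1 + x)) ≡ + 2 * (+ 1 + x) * (+ 1 + x + + 2)
    identity = solve-∀

  S-recurrenceDefect : ∀ j n →
    recurrenceDefect (+ suc j) (+ n) (S (suc j) n) (S (suc j) (suc n)) (S (suc j) (2+ n)) (S j (suc n)) (S j (2+ n)) ≡ 0ℤ
  S-recurrenceDefect j zero =
    base (S (suc j) 1) (S (suc j) 2) (S j 1) (S j 2) (S-one (suc j)) (S-two (suc j)) (S-one j) (S-two j)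
    where
    base : ∀ a₁ a₂ b₁ b₂ → a₁ ≡ + 2 * + suc j → a₂ ≡ + 2 * + suc j * (+ suc j + + 2) →
           b₁ ≡ + 2 * + j → b₂ ≡ + 2 * + j * (+ j + + 2) →
           recurrenceDefect (+ suc j) 0ℤ (+ 1) a₁ a₂ b₁ b₂ ≡ 0ℤ
    base _ _ _ _ refl refl refl refl = recurrenceDefect-base (+ j)
  S-recurrenceDefect zero (suc n) =
    trans (recurrenceDefect-step₀ (+ n) (S 1 n) (S 2 n) (S 2 (suc n)) (S 2 (2+ n)))
          (cong₂ _+_ (S-recurrenceDefect 0 n) (S-recurrenceDefect 1 n))
  S-recurrenceDefect (suc j) (suc n) =
    trans (recurrenceDefect-step (+ n) (+ suc j) (S (2+ j) n) (S (suc j) (suc n))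
             (S (suc (2+ j)) n) (S (suc (2+ j)) (suc n)) (S (suc (2+ j)) (2+ n)) (S j (2+ n)) (S j (suc (2+ n))))
          (cong₂ _+_ (cong₂ _+_ (S-recurrenceDefect j (suc n)) (S-recurrenceDefect (suc j) n))
                     (S-recurrenceDefect (2+ j) n))

module Positivity where
  open import Data.Empty using (⊥-elim)
  open import Data.Integer using (+_; -[1+_]; 0ℤ; _+_; _*_; _-_; -_; _≤_; _<_; +≤+)
  open import Data.Integer.Properties
    using (pos-*; i<j⇒suc[i]≤j; suc[i]≤j⇒i<j; i≤j⇒0≤j-i; 0≤i-j⇒j≤i; _≤?_; ≰⇒>)
  open import Data.Integer.Tactic.RingSolver using (solve-∀; solve)
  open import Data.List using (_∷_; [])
  open import Data.Nat using (z≤n)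
  open import Data.Sum using (_⊎_; inj₁; inj₂)
  open import Relation.Binary.PropositionalEquality
  open import Relation.Nullary using (¬_; yes; no)

  -- A proof of 0ℤ ≤ e is built from non-negative factors with _⊕_ and _⊗_ and then
  -- transported to e along a ring identity; x > 0 is written 0ℤ ≤ x - + 1.
  infixl 4 _by_
  infixl 6 _⊕_
  infixl 7 _⊗_

  _by_ : ∀ {a b} → 0ℤ ≤ a → a ≡ b → 0ℤ ≤ b
  p by refl = p

  _⊕_ : ∀ {a b} → 0ℤ ≤ a → 0ℤ ≤ b → 0ℤ ≤ a + b
  +≤+ _ ⊕ +≤+ _ = +≤+ z≤n

  _⊗_ : ∀ {a b} → 0ℤ ≤ a → 0ℤ ≤ b → 0ℤ ≤ a * b
  _⊗_ {+ m} {+ n} _ _ = subst (0ℤ ≤_) (pos-* m n) (+≤+ z≤n)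

  0≤+ : ∀ n → 0ℤ ≤ + n
  0≤+ n = +≤+ z≤n

  0≤square : ∀ a → 0ℤ ≤ a * a
  0≤square (+ n)    = 0≤+ n ⊗ 0≤+ n
  0≤square -[1+ n ] = +≤+ z≤n

  0≰-1 : ¬ (0ℤ ≤ - + 1)
  0≰-1 ()

  0≤3+N*⇒0≤ : ∀ {N} x → 0ℤ ≤ N → 0ℤ ≤ (+ 3 + N) * x → 0ℤ ≤ x
  0≤3+N*⇒0≤ (+ n)    _       _  = 0≤+ n
  0≤3+N*⇒0≤ -[1+ n ] (+≤+ _) ()

  <⇒0≤-1 : ∀ {a b} → a < b → 0ℤ ≤ b - a - + 1
  <⇒0≤-1 {a} {b} a<b = subst (0ℤ ≤_) (identity a b) (i≤j⇒0≤j-i (i<j⇒suc[i]≤j a<b))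
    where
    identity : ∀ a b → b - (+ 1 + a) ≡ b - a - + 1
    identity = solve-∀

  0≤-1⇒< : ∀ {a b} → 0ℤ ≤ b - a - + 1 → a < b
  0≤-1⇒< {a} {b} p = suc[i]≤j⇒i<j (0≤i-j⇒j≤i (subst (0ℤ ≤_) (identity a b) p))
    where
    identity : ∀ a b → b - a - + 1 ≡ b - (+ 1 + a)
    identity = solve-∀

  0≤-1⇒0≤ : ∀ a → 0ℤ ≤ a - + 1 → 0ℤ ≤ a
  0≤-1⇒0≤ a p = p ⊕ 0≤+ 1 by solve (a ∷ [])

  0≤⊎<0 : ∀ a → 0ℤ ≤ a ⊎ 0ℤ ≤ - a - + 1
  0≤⊎<0 a with 0ℤ ≤? a
  ... | yes 0≤a = inj₁ 0≤a
  ... | no  a≱0 = inj₂ (<⇒0≤-1 (≰⇒> a≱0) by solve (a ∷ []))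

  0≤2*+1⇒0≤ : ∀ a → 0ℤ ≤ + 2 * a + + 1 → 0ℤ ≤ a
  0≤2*+1⇒0≤ (+ n)    _ = 0≤+ n
  0≤2*+1⇒0≤ -[1+ k ] p = ⊥-elim (0≰-1 (subst (0ℤ ≤_) (identity -[1+ k ]) (p ⊕ 0≤+ 2 ⊗ 0≤+ k)))
    where
    identity : ∀ a → + 2 * a + + 1 + + 2 * (- a - + 1) ≡ - + 1
    identity = solve-∀

  0≤2*-1⇒0≤-1 : ∀ a → 0ℤ ≤ + 2 * a - + 1 → 0ℤ ≤ a - + 1
  0≤2*-1⇒0≤-1 a p = 0≤2*+1⇒0≤ (a - + 1) (subst (0ℤ ≤_) (identity a) p)
    where
    identity : ∀ a → + 2 * a - + 1 ≡ + 2 * (a - + 1) + + 1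
    identity = solve-∀

module Growth where
  open Enumeration using (schroeder; schroeder-pos)
  open ClosedForms using (S; recurrenceDefect; S-recurrenceDefect)
  open Positivity
  open import Data.Empty using (⊥-elim)
  open import Data.Integer using (ℤ; +_; 0ℤ; _+_; _*_; _-_; -_; _≤_)
  open import Data.Integer.Properties using (+-identityˡ)
  open import Data.Integer.Tactic.RingSolver using (solve)
  open import Data.List using (_∷_; [])
  open import Data.Nat as ℕ using (ℕ; zero; suc)
  open import Data.Sum using ([_,_]′)
  open import Function using (id)
  open import Relation.Binary.PropositionalEquality

  -- A record rather than an equation, so that its indices are inferred from a proof.
  record SchroederStep (N y x z : ℤ) : Set where
    constructor schroederStep
    field equation : (+ 3 + N) * z ≡ (+ 6 * N + + 9) * x - N * y

  open SchroederStep

  Q-step : ∀ {N y x z} → SchroederStep N y x z →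
    (+ 3 + N) * ((+ 3 + N) * (+ 6 * z * x - z * z - x * x)) ≡
    N * N * (+ 6 * x * y - x * x - y * y) + (+ 48 * N + + 72) * (x * x)
  Q-step {N} {y} {x} {z} step = begin
    (+ 3 + N) * ((+ 3 + N) * (+ 6 * z * x - z * z - x * x))
      ≡⟨ solve (N ∷ x ∷ z ∷ []) ⟩
    + 6 * ((+ 3 + N) * z) * ((+ 3 + N) * x) - ((+ 3 + N) * z) * ((+ 3 + N) * z) - ((+ 3 + N) * x) * ((+ 3 + N) * x)
      ≡⟨ cong (λ w → + 6 * w * ((+ 3 + N) * x) - w * w - ((+ 3 + N) * x) * ((+ 3 + N) * x)) (equation step) ⟩
    + 6 * ((+ 6 * N + + 9) * x - N * y) * ((+ 3 + N) * x) - ((+ 6 * N + + 9) * x - N * y) * ((+ 6 * N + + 9) * x - N * y)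
      - ((+ 3 + N) * x) * ((+ 3 + N) * x)
      ≡⟨ solve (N ∷ x ∷ y ∷ []) ⟩
    N * N * (+ 6 * x * y - x * x - y * y) + (+ 48 * N + + 72) * (x * x) ∎
    where open ≡-Reasoning

  doubling-step : ∀ {N y x z} → 0ℤ ≤ N → SchroederStep N y x z →
    0ℤ ≤ y → 0ℤ ≤ x → 0ℤ ≤ x - + 2 * y → 0ℤ ≤ z - + 2 * x
  doubling-step {N} {y} {x} {z} 0≤N step 0≤y 0≤x 2y≤x = 0≤3+N*⇒0≤ (z - + 2 * x) 0≤N
    (0≤N ⊗ 2y≤x ⊕ (0≤+ 3 ⊗ 0≤N ⊕ 0≤+ 3) ⊗ 0≤x ⊕ 0≤N ⊗ 0≤y by sym (begin
      (+ 3 + N) * (z - + 2 * x)                          ≡⟨ solve (N ∷ x ∷ z ∷ []) ⟩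
      (+ 3 + N) * z - (+ 6 + + 2 * N) * x                ≡⟨ cong (λ w → w - (+ 6 + + 2 * N) * x) (equation step) ⟩
      (+ 6 * N + + 9) * x - N * y - (+ 6 + + 2 * N) * x  ≡⟨ solve (N ∷ x ∷ y ∷ []) ⟩
      N * (x - + 2 * y) + (+ 3 * N + + 3) * x + N * y    ∎))
    where open ≡-Reasoning

  Q-pos-step : ∀ {N y x z} → 0ℤ ≤ N → SchroederStep N y x z →
    0ℤ ≤ x - + 1 → 0ℤ ≤ + 6 * x * y - x * x - y * y - + 1 → 0ℤ ≤ + 6 * z * x - z * z - x * x - + 1
  Q-pos-step {N} {y} {x} {z} 0≤N step 1≤x 1≤Qxy =
    0≤3+N*⇒0≤ _ 0≤N (0≤3+N*⇒0≤ _ 0≤N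
      ((0≤N ⊗ 0≤N) ⊗ 1≤Qxy ⊕ (0≤+ 48 ⊗ 0≤N ⊕ 0≤+ 72) ⊗ (1≤x ⊗ (1≤x ⊕ 0≤+ 2)) ⊕ (0≤+ 42 ⊗ 0≤N ⊕ 0≤+ 63)
       by sym (begin
         (+ 3 + N) * ((+ 3 + N) * (+ 6 * z * x - z * z - x * x - + 1))
           ≡⟨ solve (N ∷ x ∷ z ∷ []) ⟩
         (+ 3 + N) * ((+ 3 + N) * (+ 6 * z * x - z * z - x * x)) - (+ 3 + N) * (+ 3 + N)
           ≡⟨ cong (λ w → w - (+ 3 + N) * (+ 3 + N)) (Q-step step) ⟩
         N * N * (+ 6 * x * y - x * x - y * y) + (+ 48 * N + + 72) * (x * x) - (+ 3 + N) * (+ 3 + N)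
           ≡⟨ solve (N ∷ x ∷ y ∷ []) ⟩
         N * N * (+ 6 * x * y - x * x - y * y - + 1) + (+ 48 * N + + 72) * ((x - + 1) * (x - + 1 + + 2))
           + (+ 42 * N + + 63) ∎)))
    where open ≡-Reasoning

  Q-decay-step : ∀ {N y x z} → 0ℤ ≤ N → SchroederStep N y x z →
    0ℤ ≤ y → 0ℤ ≤ x - + 2 * y → 0ℤ ≤ + 6 * x * y - x * x - y * y →
    0ℤ ≤ + 64 * (+ 1 + N) * (y * y) - (+ 2 + N) * ((+ 2 + N) * (+ 6 * x * y - x * x - y * y)) →
    0ℤ ≤ + 64 * (+ 1 + (+ 1 + N)) * (x * x) - (+ 2 + (+ 1 + N)) * ((+ 2 + (+ 1 + N)) * (+ 6 * z * x - z * z - x * x))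
  Q-decay-step {N} {y} {x} {z} 0≤N step 0≤y 2y≤x 0≤Qxy decay =
    decay ⊕ (0≤+ 4 ⊗ 0≤N ⊕ 0≤+ 4) ⊗ 0≤Qxy ⊕ (0≤+ 16 ⊗ (0≤+ 1 ⊕ 0≤N)) ⊗ (2y≤x ⊗ (2y≤x ⊕ 0≤+ 4 ⊗ 0≤y))
      ⊕ 0≤+ 40 ⊗ 0≤square x
    by sym (begin
      + 64 * (+ 1 + (+ 1 + N)) * (x * x) - (+ 2 + (+ 1 + N)) * ((+ 2 + (+ 1 + N)) * (+ 6 * z * x - z * z - x * x))
        ≡⟨ solve (N ∷ x ∷ z ∷ []) ⟩
      + 64 * (+ 2 + N) * (x * x) - (+ 3 + N) * ((+ 3 + N) * (+ 6 * z * x - z * z - x * x))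
        ≡⟨ cong (λ w → + 64 * (+ 2 + N) * (x * x) - w) (Q-step step) ⟩
      + 64 * (+ 2 + N) * (x * x) - (N * N * (+ 6 * x * y - x * x - y * y) + (+ 48 * N + + 72) * (x * x))
        ≡⟨ solve (N ∷ x ∷ y ∷ []) ⟩
      + 64 * (+ 1 + N) * (y * y) - (+ 2 + N) * ((+ 2 + N) * (+ 6 * x * y - x * x - y * y))
        + (+ 4 * N + + 4) * (+ 6 * x * y - x * x - y * y)
        + + 16 * (+ 1 + N) * ((x - + 2 * y) * (x - + 2 * y + + 4 * y)) + + 40 * (x * x) ∎)
    where open ≡-Reasoning

  defect⇒schroederStep : ∀ N a₀ a₁ a₂ → recurrenceDefect (+ 1) N a₀ a₁ a₂ 0ℤ 0ℤ ≡ 0ℤ →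
    SchroederStep N a₀ a₁ a₂
  defect⇒schroederStep N a₀ a₁ a₂ defect = schroederStep (begin
    (+ 3 + N) * a₂
      ≡⟨ solve (N ∷ a₀ ∷ a₁ ∷ a₂ ∷ []) ⟩
    (N + + 2) * a₂ - + 6 * (N + + 1) * a₁ + N * a₀ - + 1 * (+ 3 * a₁ - a₂ + 0ℤ + 0ℤ) + ((+ 6 * N + + 9) * a₁ - N * a₀)
      ≡⟨ cong (_+ ((+ 6 * N + + 9) * a₁ - N * a₀)) defect ⟩
    0ℤ + ((+ 6 * N + + 9) * a₁ - N * a₀)
      ≡⟨ +-identityˡ _ ⟩
    (+ 6 * N + + 9) * a₁ - N * a₀ ∎)
    where open ≡-Reasoning

  r : ℕ → ℤ
  r n = S 1 n

  r-step : ∀ n → SchroederStep (+ n) (r n) (r (suc n)) (r (ℕ.2+ n))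
  r-step n = defect⇒schroederStep (+ n) (r n) (r (suc n)) (r (ℕ.2+ n)) (S-recurrenceDefect 0 n)

  1≤r : ∀ n → 0ℤ ≤ r n - + 1
  1≤r n with schroeder 1 n | schroeder-pos 0 n
  ... | suc m | _ = 0≤+ m

  0≤r : ∀ n → 0ℤ ≤ r n
  0≤r n = 0≤+ (schroeder 1 n)

  r-doubling : ∀ n → 0ℤ ≤ r (suc n) - + 2 * r n
  r-doubling zero    = 0≤+ 0
  r-doubling (suc n) = doubling-step (0≤+ n) (r-step n) (0≤r n) (0≤r (suc n)) (r-doubling n)

  r-Q-pos : ∀ n → 0ℤ ≤ + 6 * r (suc n) * r n - r (suc n) * r (suc n) - r n * r n - + 1
  r-Q-pos zero    = 0≤+ 6
  r-Q-pos (suc n) = Q-pos-step (0≤+ n) (r-step n) (1≤r (suc n)) (r-Q-pos n)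

  r-Q-decay : ∀ n → 0ℤ ≤ + 64 * (+ 1 + + n) * (r n * r n) -
                         (+ 2 + + n) * ((+ 2 + + n) * (+ 6 * r (suc n) * r n - r (suc n) * r (suc n) - r n * r n))
  r-Q-decay zero    = 0≤+ 36
  -- Abstracting the index lets the conversion checker compare + 1 + + n with + suc n
  -- directly instead of unfolding r.
  r-Q-decay (suc n) =
    subst (λ M → 0ℤ ≤ + 64 * (+ 1 + M) * (r (suc n) * r (suc n)) - (+ 2 + M) * ((+ 2 + M) *
                     (+ 6 * r (ℕ.2+ n) * r (suc n) - r (ℕ.2+ n) * r (ℕ.2+ n) - r (suc n) * r (suc n))))
          {+ 1 + + n} {+ suc n} refl
      (Q-decay-step (0≤+ n) (r-step n) (0≤r n) (r-doubling n)
        (0≤-1⇒0≤ (+ 6 * r (suc n) * r n - r (suc n) * r (suc n) - r n * r n) (r-Q-pos n)) (r-Q-decay n))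

  -- On 2 ≤ t = z / x ≤ d / e the concave 6t - t² - 1 is at least its value at an end
  -- point: 7 at t = 2, and ≥ 1 / e² at t = d / e.
  Q-on-segment : ∀ {d e x z} → 0ℤ ≤ e - + 1 → 0ℤ ≤ z - + 2 * x → 0ℤ ≤ d * x - e * z → 0ℤ ≤ x - + 1 →
    0ℤ ≤ + 6 * d * e - d * d - e * e - + 1 → 0ℤ ≤ e * e * (+ 6 * z * x - z * z - x * x) - x * x
  Q-on-segment {d} {e} {x} {z} 1≤e 2x≤z ez≤dx 1≤x 1≤Qde = [ when-4e≥d , when-4e<d ]′ (0≤⊎<0 (+ 4 * e - d))
    where
    when-4e≥d : 0ℤ ≤ + 4 * e - d → 0ℤ ≤ e * e * (+ 6 * z * x - z * z - x * x) - x * x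
    when-4e≥d 0≤4e-d =
      0≤-1⇒0≤ e 1≤e ⊗ (2x≤z ⊗ ez≤dx ⊕ 0≤4e-d ⊗ (2x≤z ⊗ 0≤-1⇒0≤ x 1≤x))
        ⊕ (0≤+ 7 ⊗ (1≤e ⊗ (1≤e ⊕ 0≤+ 2)) ⊕ 0≤+ 6) ⊗ 0≤square x
      by solve (d ∷ e ∷ x ∷ z ∷ [])
    when-4e<d : 0ℤ ≤ - (+ 4 * e - d) - + 1 → 0ℤ ≤ e * e * (+ 6 * z * x - z * z - x * x) - x * x
    when-4e<d 4e<d =
      0≤-1⇒0≤ e 1≤e ⊗ (2x≤z ⊗ ez≤dx) ⊕ (4e<d ⊕ 0≤+ 1) ⊗ (0≤-1⇒0≤ x 1≤x ⊗ ez≤dx) ⊕ 1≤Qde ⊗ 0≤square x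
      by solve (d ∷ e ∷ x ∷ z ∷ [])

  -- If z / x < d / e then Q z x ≥ x² / e², contradicting the decay bound once
  -- N + 1 ≥ 64 e².
  ratio-lower-bound : ∀ {N d e x z} → 0ℤ ≤ N → 0ℤ ≤ x - + 1 → 0ℤ ≤ z - + 2 * x → 0ℤ ≤ e - + 1 →
    0ℤ ≤ + 6 * d * e - d * d - e * e - + 1 → 0ℤ ≤ + 1 + N - + 64 * (e * e) →
    0ℤ ≤ + 64 * (+ 1 + N) * (x * x) - (+ 2 + N) * ((+ 2 + N) * (+ 6 * z * x - z * z - x * x)) →
    0ℤ ≤ e * z - d * x
  ratio-lower-bound {N} {d} {e} {x} {z} 0≤N 1≤x 2x≤z 1≤e 1≤Qde 64e²≤1+N decay =
    [ id , impossible ]′ (0≤⊎<0 (e * z - d * x))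
    where
    far-impossible : 0ℤ ≤ e * e * (+ 6 * z * x - z * z - x * x) - x * x → 0ℤ ≤ - + 1
    far-impossible far =
      0≤square e ⊗ decay ⊕ (0≤+ 2 ⊕ 0≤N) ⊗ ((0≤+ 2 ⊕ 0≤N) ⊗ far) ⊕ ((0≤+ 1 ⊕ 0≤N) ⊗ 64e²≤1+N) ⊗ 0≤square x
        ⊕ (0≤+ 2 ⊗ 0≤N ⊕ 0≤+ 2) ⊗ 0≤square x ⊕ 1≤x ⊗ (0≤-1⇒0≤ x 1≤x ⊕ 0≤+ 1)
      by solve (N ∷ e ∷ x ∷ z ∷ [])
    impossible : 0ℤ ≤ - (e * z - d * x) - + 1 → 0ℤ ≤ e * z - d * x
    impossible ez<dx =
      ⊥-elim (0≰-1 (far-impossible (Q-on-segment {d} {e} {x} {z} 1≤e 2x≤z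
        (ez<dx ⊕ 0≤+ 1 by solve (d ∷ e ∷ x ∷ z ∷ [])) 1≤x 1≤Qde)))

  -- Q z x ≥ 0 gives 1 - x / z ≤ 2 (√2 - 1) < 2 (s / d - 1), and N > s d absorbs the
  -- factor (N + 1) / N.
  ratio-gap-bound : ∀ {N d s x z} → 0ℤ ≤ x → 0ℤ ≤ z - x → 0ℤ ≤ z - + 1 → 0ℤ ≤ d - + 1 → 0ℤ ≤ s - + 1 →
    0ℤ ≤ s * s - + 2 * (d * d) - + 1 → 0ℤ ≤ N - s * d - + 1 → 0ℤ ≤ + 6 * z * x - z * z - x * x →
    0ℤ ≤ + 2 * (s - d) * N * z - d * (+ 1 + N) * (z - x) - + 1
  ratio-gap-bound {N} {d} {s} {x} {z} 0≤x x≤z 1≤z 1≤d 1≤s 2d²<s² sd<N 0≤Qzx =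
    [ id , impossible ]′ (0≤⊎<0 (+ 2 * (s - d) * N * z - d * (+ 1 + N) * (z - x) - + 1))
    where
    0≤s : 0ℤ ≤ s
    0≤s = 0≤-1⇒0≤ s 1≤s
    0≤d : 0ℤ ≤ d
    0≤d = 0≤-1⇒0≤ d 1≤d
    0≤z : 0ℤ ≤ z
    0≤z = 0≤-1⇒0≤ z 1≤z
    0≤N : 0ℤ ≤ N
    0≤N = sd<N ⊕ 0≤s ⊗ 0≤d ⊕ 0≤+ 1 by solve (N ∷ d ∷ s ∷ [])
    1≤N : 0ℤ ≤ N - + 1
    1≤N = sd<N ⊕ 0≤s ⊗ 0≤d by solve (N ∷ d ∷ s ∷ [])
    0≤P : 0ℤ ≤ d * N * ((z - x) + + 2 * z)
    0≤P = 0≤d ⊗ 0≤N ⊗ (x≤z ⊕ 0≤+ 2 ⊗ 0≤z)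
    0≤R : 0ℤ ≤ + 2 * s * N * z - d * (z - x)
    0≤R = (0≤+ 2 ⊗ 0≤s ⊗ sd<N ⊕ 0≤d ⊗ (0≤+ 2 ⊗ (1≤s ⊗ (1≤s ⊕ 0≤+ 2)) ⊕ 0≤+ 1) ⊕ 0≤+ 2 ⊗ 0≤s) ⊗ 0≤z ⊕ 0≤d ⊗ 0≤x
          by solve (N ∷ d ∷ s ∷ x ∷ z ∷ [])
    P<R-impossible : 0ℤ ≤ d * N * ((z - x) + + 2 * z) - (+ 2 * s * N * z - d * (z - x)) → 0ℤ ≤ - + 1
    P<R-impossible R≤P =
      R≤P ⊗ (0≤P ⊕ 0≤R) ⊕ (0≤square d ⊗ 0≤square N) ⊗ 0≤Qzx ⊕ (0≤+ 4 ⊗ 0≤square N ⊗ 0≤square z) ⊗ 2d²<s²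
        ⊕ 0≤square (d * (z - x)) ⊕ 0≤+ 4 ⊗ 0≤s ⊗ 0≤d ⊗ 0≤N ⊗ 0≤z ⊗ 0≤x ⊕ 0≤+ 4 ⊗ 0≤N ⊗ 0≤square z ⊗ sd<N
        ⊕ 0≤+ 4 ⊗ (1≤N ⊗ 0≤square z ⊕ 1≤z ⊗ (0≤z ⊕ 0≤+ 1)) ⊕ 0≤+ 3
      by solve (N ∷ d ∷ s ∷ x ∷ z ∷ [])
    impossible : 0ℤ ≤ - (+ 2 * (s - d) * N * z - d * (+ 1 + N) * (z - x) - + 1) - + 1 →
                 0ℤ ≤ + 2 * (s - d) * N * z - d * (+ 1 + N) * (z - x) - + 1
    impossible bad = ⊥-elim (0≰-1 (P<R-impossible (bad by solve (N ∷ d ∷ s ∷ x ∷ z ∷ []))))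

module AscentBounds where
  open Enumeration using (schroederAscents)
  open ClosedForms using (twice-schroederAscents)
  open Positivity
  open Growth
  open import Data.Bool using (false)
  open import Data.Empty using (⊥-elim)
  open import Data.Integer using (+_; 0ℤ; _+_; _*_; _-_; -_; _≤_)
  open import Data.Integer.Tactic.RingSolver using (solve-∀; solve)
  open import Data.List using (_∷_; [])
  open import Data.Nat using (suc)
  open import Data.Sum using (_⊎_; [_,_]′)
  open import Function using (id)
  open import Relation.Binary.PropositionalEquality

  twice-ascents-closedForm : ∀ m → + 2 * + schroederAscents false 1 (suc m) ≡ (+ 2 + + m) * (r (suc m) - r m)
  twice-ascents-closedForm m = trans (twice-schroederAscents false 0 (suc m)) (identity (+ m) (r (suc m)) (r m))
    where
    identity : ∀ M a c → (+ 1 + (+ 1 + M)) * a - + 1 * 0ℤ - (+ 2 * + 1 + (+ 1 + M) - + 1) * c ≡ (+ 2 + M) * (a - c)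
    identity = solve-∀

  -- With e = d - 2α the claim reduces to e z ≥ d x, i.e. x / z ≤ 1 - 2α / d.
  ascents-lower-bound : ∀ {α d M T x z} → 0ℤ ≤ M → + 2 * T ≡ (+ 2 + M) * (z - x) →
    0ℤ ≤ x - + 1 → 0ℤ ≤ z - + 2 * x →
    0ℤ ≤ + 64 * (+ 1 + M) * (x * x) - (+ 2 + M) * ((+ 2 + M) * (+ 6 * z * x - z * z - x * x)) →
    0ℤ ≤ d - + 1 → 0ℤ ≤ - (α + d) - + 1 ⊎ 0ℤ ≤ + 2 * (d * d) - (α + d) * (α + d) - + 1 →
    0ℤ ≤ M - + 64 * ((d - + 2 * α) * (d - + 2 * α)) →
    0ℤ ≤ T * d - α * (+ 1 + M) * z - + 1
  ascents-lower-bound {α} {d} {M} {T} {x} {z} 0≤M twoT 1≤x 2x≤z decay 1≤d below threshold =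
    [ α-positive , α-nonpositive ]′ (0≤⊎<0 (α - + 1))
    where
    0≤x : 0ℤ ≤ x
    0≤x = 0≤-1⇒0≤ x 1≤x
    x<z : 0ℤ ≤ z - x - + 1
    x<z = 2x≤z ⊕ 1≤x by solve (x ∷ z ∷ [])
    x≤z : 0ℤ ≤ z - x
    x≤z = 0≤-1⇒0≤ (z - x) x<z
    1≤2T : 0ℤ ≤ (+ 2 + M) * (z - x) - + 1
    1≤2T = (0≤+ 1 ⊕ 0≤M) ⊗ x≤z ⊕ x<z by solve (M ∷ x ∷ z ∷ [])
    1≤T : 0ℤ ≤ T - + 1
    1≤T = 0≤2*-1⇒0≤-1 T (1≤2T by cong (_- + 1) (sym twoT))
    α-nonpositive : 0ℤ ≤ - (α - + 1) - + 1 → 0ℤ ≤ T * d - α * (+ 1 + M) * z - + 1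
    α-nonpositive α≤0 =
      1≤T ⊗ 0≤-1⇒0≤ d 1≤d ⊕ 1≤d ⊕ α≤0 ⊗ (0≤+ 1 ⊕ 0≤M) ⊗ 0≤-1⇒0≤ z (x<z ⊕ 0≤x by solve (x ∷ z ∷ []))
      by solve (α ∷ d ∷ M ∷ T ∷ z ∷ [])
    α-positive : 0ℤ ≤ α - + 1 → 0ℤ ≤ T * d - α * (+ 1 + M) * z - + 1
    α-positive 1≤α = [ sum-negative , from-square ]′ below
      where
      sum-negative : 0ℤ ≤ - (α + d) - + 1 → 0ℤ ≤ T * d - α * (+ 1 + M) * z - + 1
      sum-negative α+d<0 = ⊥-elim (0≰-1 (α+d<0 ⊕ 1≤α ⊕ 1≤d ⊕ 0≤+ 2 by solve (α ∷ d ∷ [])))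
      from-square : 0ℤ ≤ + 2 * (d * d) - (α + d) * (α + d) - + 1 → 0ℤ ≤ T * d - α * (+ 1 + M) * z - + 1
      from-square [α+d]²<2d² =
        0≤2*-1⇒0≤-1 (T * d - α * (+ 1 + M) * z) (twice by solve (α ∷ d ∷ M ∷ T ∷ z ∷ []))
        where
        2α<d : 0ℤ ≤ d - + 2 * α - + 1
        2α<d = [ id , impossible ]′ (0≤⊎<0 (d - + 2 * α - + 1))
          where
          impossible : 0ℤ ≤ - (d - + 2 * α - + 1) - + 1 → 0ℤ ≤ d - + 2 * α - + 1
          impossible d≤2α = ⊥-elim (0≰-1
            (0≤+ 4 ⊗ [α+d]²<2d² ⊕ d≤2α ⊗ (0≤+ 2 ⊗ 1≤α ⊕ 0≤+ 5 ⊗ 1≤d ⊕ 0≤+ 7) ⊕ 0≤square d ⊕ 0≤+ 3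
             by solve (α ∷ d ∷ [])))
        inside : 0ℤ ≤ + 6 * d * (d - + 2 * α) - d * d - (d - + 2 * α) * (d - + 2 * α) - + 1
        inside = 0≤+ 4 ⊗ [α+d]²<2d² ⊕ 0≤+ 3 by solve (α ∷ d ∷ [])
        past-threshold : 0ℤ ≤ + 1 + M - + 64 * ((d - + 2 * α) * (d - + 2 * α))
        past-threshold = threshold ⊕ 0≤+ 1 by solve (α ∷ d ∷ M ∷ [])
        z-over-x : 0ℤ ≤ (d - + 2 * α) * z - d * x
        z-over-x = ratio-lower-bound {M} {d} {d - + 2 * α} {x} {z} 0≤M 1≤x 2x≤z 2α<d inside past-threshold decay
        twice′ : 0ℤ ≤ (+ 2 + M) * (z - x) * d - + 2 * α * (+ 1 + M) * z - + 1
        twice′ = (0≤+ 1 ⊕ 0≤M) ⊗ z-over-x ⊕ (1≤d ⊗ x≤z ⊕ x<z) by solve (α ∷ d ∷ M ∷ x ∷ z ∷ [])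
        twice : 0ℤ ≤ + 2 * T * d - + 2 * α * (+ 1 + M) * z - + 1
        twice = twice′ by cong (λ w → w * d - + 2 * α * (+ 1 + M) * z - + 1) (sym twoT)

  ascents-upper-bound : ∀ {β d M T x z} → 0ℤ ≤ M → + 2 * T ≡ (+ 2 + M) * (z - x) →
    0ℤ ≤ x - + 1 → 0ℤ ≤ z - + 2 * x → 0ℤ ≤ + 6 * z * x - z * z - x * x →
    0ℤ ≤ d - + 1 → 0ℤ ≤ β + d - + 1 → 0ℤ ≤ (β + d) * (β + d) - + 2 * (d * d) - + 1 →
    0ℤ ≤ M - (β + d) * d →
    0ℤ ≤ β * (+ 1 + M) * z - T * d - + 1
  ascents-upper-bound {β} {d} {M} {T} {x} {z} 0≤M twoT 1≤x 2x≤z 0≤Qzx 1≤d 1≤β+d 2d²<[β+d]² threshold =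
    0≤2*-1⇒0≤-1 (β * (+ 1 + M) * z - T * d) (twice by solve (β ∷ d ∷ M ∷ T ∷ z ∷ []))
    where
    0≤x : 0ℤ ≤ x
    0≤x = 0≤-1⇒0≤ x 1≤x
    x≤z : 0ℤ ≤ z - x
    x≤z = 2x≤z ⊕ 0≤x by solve (x ∷ z ∷ [])
    x-over-z : 0ℤ ≤ + 2 * (β + d - d) * (+ 1 + M) * z - d * (+ 1 + (+ 1 + M)) * (z - x) - + 1
    x-over-z = ratio-gap-bound {+ 1 + M} {d} {β + d} {x} {z} 0≤x x≤z
                 (2x≤z ⊕ 0≤x ⊕ 1≤x by solve (x ∷ z ∷ [])) 1≤d 1≤β+d 2d²<[β+d]²
                 (threshold by solve (β ∷ d ∷ M ∷ [])) 0≤Qzx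
    twice′ : 0ℤ ≤ + 2 * β * (+ 1 + M) * z - (+ 2 + M) * (z - x) * d - + 1
    twice′ = x-over-z by solve (β ∷ d ∷ M ∷ x ∷ z ∷ [])
    twice : 0ℤ ≤ + 2 * β * (+ 1 + M) * z - + 2 * T * d - + 1
    twice = twice′ by cong (λ w → + 2 * β * (+ 1 + M) * z - w * d - + 1) (sym twoT)

module RationalBounds where
  open Positivity using (_by_; <⇒0≤-1; 0≤-1⇒<)
  open import Data.Integer using (+_; 0ℤ; _+_; _*_; _-_; -_; _≤_; _<_)
  open import Data.Integer.Properties using (pos-*)
  open import Data.Integer.Tactic.RingSolver using (solve)
  open import Data.List using (_∷_; [])
  open import Data.Nat as ℕ using (suc)
  open import Data.Nat.Properties using (*-identityʳ)
  open import Data.Product using (_×_; _,_)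
  open import Data.Rational.Unnormalised.Base as ℚ using (mkℚᵘ; *<*)
  open import Data.Sum using (_⊎_; inj₁; inj₂)
  open import Relation.Binary.PropositionalEquality

  -- Multiplying by fromℕ n leaves the denominator of mkℚᵘ α da as suc (da * 1).
  denominator-*1 : ∀ da → + suc (da ℕ.* 1) ≡ + suc da
  denominator-*1 da = cong (λ n → + suc n) (*-identityʳ da)

  lower-ℚᵘ : ∀ α da m T k → 0ℤ ≤ + T * + suc da - α * (+ 1 + + m) * + suc k - + 1 →
    mkℚᵘ α da ℚ.* fromℕ (suc m) ℚ.< mkℚᵘ (+ T) k
  lower-ℚᵘ α da m T k h = *<* (0≤-1⇒<
    (subst (λ δ → 0ℤ ≤ + T * δ - α * (+ 1 + + m) * + suc k - + 1) (sym (denominator-*1 da)) h))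

  upper-ℚᵘ : ∀ β db m T k → 0ℤ ≤ β * (+ 1 + + m) * + suc k - + T * + suc db - + 1 →
    mkℚᵘ (+ T) k ℚ.< mkℚᵘ β db ℚ.* fromℕ (suc m)
  upper-ℚᵘ β db m T k h = *<* (0≤-1⇒<
    (subst (λ δ → 0ℤ ≤ β * (+ 1 + + m) * + suc k - + T * δ - + 1) (sym (denominator-*1 db)) h))

  square-denominator : ∀ da → + suc (da ℕ.* 1 ℕ.+ da ℕ.* 1 ℕ.* suc (da ℕ.* 1)) ≡ + suc da * + suc da
  square-denominator da =
    trans (pos-* (suc (da ℕ.* 1)) (suc (da ℕ.* 1))) (cong₂ _*_ (denominator-*1 da) (denominator-*1 da))

  BelowSqrt2m1⇒ℤ : ∀ α da → BelowSqrt2m1 (mkℚᵘ α da) →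
    0ℤ ≤ - (α + + suc da) - + 1 ⊎ 0ℤ ≤ + 2 * (+ suc da * + suc da) - (α + + suc da) * (α + + suc da) - + 1
  BelowSqrt2m1⇒ℤ α da (inj₁ (*<* a+1<0)) = inj₁ (negative α (+ suc da) (+ suc (da ℕ.* 1)) a+1<0)
    where
    negative : ∀ α d d′ → (α * + 1 + + 1 * d) * + 1 < + 0 * d′ → 0ℤ ≤ - (α + d) - + 1
    negative α d d′ h = <⇒0≤-1 h by solve (α ∷ d ∷ d′ ∷ [])
  BelowSqrt2m1⇒ℤ α da (inj₂ (*<* [a+1]²<2)) =
    inj₂ (square α (+ suc da) _ (square-denominator da) [a+1]²<2)
    where
    square : ∀ α d dd → dd ≡ d * d → (α * + 1 + + 1 * d) * (α * + 1 + + 1 * d) * + 1 < + 2 * dd →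
      0ℤ ≤ + 2 * (d * d) - (α + d) * (α + d) - + 1
    square α d dd eq h =
      <⇒0≤-1 (subst (λ X → (α * + 1 + + 1 * d) * (α * + 1 + + 1 * d) * + 1 < + 2 * X) eq h)
      by solve (α ∷ d ∷ [])

  AboveSqrt2m1⇒ℤ : ∀ β db → AboveSqrt2m1 (mkℚᵘ β db) →
    0ℤ ≤ β + + suc db - + 1 × 0ℤ ≤ (β + + suc db) * (β + + suc db) - + 2 * (+ suc db * + suc db) - + 1
  AboveSqrt2m1⇒ℤ β db (*<* 0<b+1 , *<* 2<[b+1]²) =
    positive β (+ suc db) (+ suc (db ℕ.* 1)) 0<b+1 , square β (+ suc db) _ (square-denominator db) 2<[b+1]²
    where
    positive : ∀ β d d′ → + 0 * d′ < (β * + 1 + + 1 * d) * + 1 → 0ℤ ≤ β + d - + 1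
    positive β d d′ h = <⇒0≤-1 h by solve (β ∷ d ∷ d′ ∷ [])
    square : ∀ β d dd → dd ≡ d * d → + 2 * dd < (β * + 1 + + 1 * d) * (β * + 1 + + 1 * d) * + 1 →
      0ℤ ≤ (β + d) * (β + d) - + 2 * (d * d) - + 1
    square β d dd eq h =
      <⇒0≤-1 (subst (λ X → + 2 * X < (β * + 1 + + 1 * d) * (β * + 1 + + 1 * d) * + 1) eq h)
      by solve (β ∷ d ∷ [])

open Enumeration using (schroeder; schroederAscents; schroeder-pos; sum-ascents-schroederPaths; length-schroederPaths)
open Positivity using (_by_; 0≤+; 0≤-1⇒0≤)
open Growth using (r; 1≤r; r-doubling; r-Q-pos; r-Q-decay)
open AscentBounds
open RationalBounds
open import Data.Bool using (false)
open import Data.Integer as ℤ using (+_; 0ℤ; _-_; _≤_; ∣_∣; +≤+; -[1+_])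
open import Data.Integer.Properties using (pos-*; i≤j⇒0≤j-i)
open import Data.Nat as ℕ using (ℕ; suc; s≤s; _≥_)
open import Data.Nat.Properties using (m≤m+n; m≤n+m; ≤-trans)
open import Data.Product using (Σ; _,_; _×_; proj₁; proj₂)
open import Data.Rational.Unnormalised.Base using (ℚᵘ; mkℚᵘ; _<_; _*_)
open import Relation.Binary.PropositionalEquality

expectedAscents-closedForm : ∀ n → expectedAscents n ≡ ratio (schroederAscents false 1 n) (schroeder 1 n)
expectedAscents-closedForm n = cong₂ ratio (sum-ascents-schroederPaths n) (length-schroederPaths n)

expectedAscents-mkℚᵘ : ∀ m → Σ ℕ λ k →
  expectedAscents (suc m) ≡ mkℚᵘ (+ schroederAscents false 1 (suc m)) k × + suc k ≡ r (suc m)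
expectedAscents-mkℚᵘ m with schroeder 1 (suc m) | schroeder-pos 0 (suc m) | expectedAscents-closedForm (suc m)
... | suc k | _ | eq = k , eq , refl

0≤m-64e² : ∀ e m → 64 ℕ.* (∣ e ∣ ℕ.* ∣ e ∣) ℕ.≤ m → 0ℤ ≤ + m - + 64 ℤ.* (e ℤ.* e)
0≤m-64e² e m 64e²≤m =
  i≤j⇒0≤j-i (+≤+ 64e²≤m)
    by cong (+ m -_) (trans (pos-* 64 (∣ e ∣ ℕ.* ∣ e ∣)) (cong (+ 64 ℤ.*_) (∣e∣²≡e² e)))
  where
  ∣e∣²≡e² : ∀ e → + (∣ e ∣ ℕ.* ∣ e ∣) ≡ e ℤ.* e
  ∣e∣²≡e² (+ n)    = pos-* n n
  ∣e∣²≡e² -[1+ n ] = refl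

0≤m-sd : ∀ s d m → 0ℤ ≤ s → ∣ s ∣ ℕ.* d ℕ.≤ m → 0ℤ ≤ + m - s ℤ.* + d
0≤m-sd (+ s) d m _ sd≤m = i≤j⇒0≤j-i (+≤+ sd≤m) by cong (+ m -_) (pos-* s d)

expectedAscents-above : ∀ α da m → BelowSqrt2m1 (mkℚᵘ α da) →
  64 ℕ.* (∣ + suc da - + 2 ℤ.* α ∣ ℕ.* ∣ + suc da - + 2 ℤ.* α ∣) ℕ.≤ m →
  mkℚᵘ α da * fromℕ (suc m) < expectedAscents (suc m)
expectedAscents-above α da m a<√2-1 threshold with expectedAscents-mkℚᵘ m
... | k , eq , k≡r rewrite eq = lower-ℚᵘ α da m T k
  (subst (λ z → 0ℤ ≤ + T ℤ.* + suc da - α ℤ.* (+ 1 ℤ.+ + m) ℤ.* z - + 1) (sym k≡r)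
    (ascents-lower-bound {α} {+ suc da} {+ m} {+ T} {r m} {r (suc m)}
      (0≤+ m) (twice-ascents-closedForm m) (1≤r m) (r-doubling m) (r-Q-decay m)
      (0≤+ da) (BelowSqrt2m1⇒ℤ α da a<√2-1) (0≤m-64e² (+ suc da - + 2 ℤ.* α) m threshold)))
  where
  T : ℕ
  T = schroederAscents false 1 (suc m)

expectedAscents-below : ∀ β db m → AboveSqrt2m1 (mkℚᵘ β db) →
  ∣ β ℤ.+ + suc db ∣ ℕ.* suc db ℕ.≤ m →
  expectedAscents (suc m) < mkℚᵘ β db * fromℕ (suc m)
expectedAscents-below β db m √2-1<b threshold with expectedAscents-mkℚᵘ m
... | k , eq , k≡r rewrite eq = upper-ℚᵘ β db m T k
  (subst (λ z → 0ℤ ≤ β ℤ.* (+ 1 ℤ.+ + m) ℤ.* z - + T ℤ.* + suc db - + 1) (sym k≡r)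
    (ascents-upper-bound {β} {+ suc db} {+ m} {+ T} {r m} {r (suc m)}
      (0≤+ m) (twice-ascents-closedForm m) (1≤r m) (r-doubling m) (0≤-1⇒0≤ _ (r-Q-pos m))
      (0≤+ db) 1≤b+1 2<[b+1]² (0≤m-sd (β ℤ.+ + suc db) (suc db) m (0≤-1⇒0≤ _ 1≤b+1) threshold)))
  where
  T : ℕ
  T = schroederAscents false 1 (suc m)
  1≤b+1 : 0ℤ ≤ β ℤ.+ + suc db - + 1
  1≤b+1 = proj₁ (AboveSqrt2m1⇒ℤ β db √2-1<b)
  2<[b+1]² : 0ℤ ≤ (β ℤ.+ + suc db) ℤ.* (β ℤ.+ + suc db) - + 2 ℤ.* (+ suc db ℤ.* + suc db) - + 1
  2<[b+1]² = proj₂ (AboveSqrt2m1⇒ℤ β db √2-1<b)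

mainTheorem4 : (a b : ℚᵘ) → BelowSqrt2m1 a → AboveSqrt2m1 b →
    Σ ℕ (λ N → (n : ℕ) → n ≥ N →
      ((a * fromℕ n) < expectedAscents n) Data.Product.× (expectedAscents n < (b * fromℕ n)))
mainTheorem4 (mkℚᵘ α da) (mkℚᵘ β db) a<√2-1 √2-1<b = suc (K₁ ℕ.+ K₂) , bounds
  where
  K₁ K₂ : ℕ
  K₁ = 64 ℕ.* (∣ + suc da - + 2 ℤ.* α ∣ ℕ.* ∣ + suc da - + 2 ℤ.* α ∣)
  K₂ = ∣ β ℤ.+ + suc db ∣ ℕ.* suc db
  bounds : (n : ℕ) → n ≥ suc (K₁ ℕ.+ K₂) →
    (mkℚᵘ α da * fromℕ n < expectedAscents n) × (expectedAscents n < mkℚᵘ β db * fromℕ n)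
  bounds (suc m) (s≤s K≤m) =
    expectedAscents-above α da m a<√2-1 (≤-trans (m≤m+n K₁ K₂) K≤m) ,
    expectedAscents-below β db m √2-1<b (≤-trans (m≤n+m K₂ K₁) K≤m)
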